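{- Let $t\ge 1$ and let $m_1,\dots,m_t\ge 3$ and $n_1,\dots,n_t\ge 0$ be integers such that $m_t\equiv 0\pmod 2$ and, if $t\ge 2$, $m_i\equiv 0\pmod 4$ and $n_i\equiv 0\pmod 2$ for $i=1,\dots,t-1$. Then the graph $C_{m_1,(n_1),m_2,(n_2),\dots,m_t,(n_t)}$ admits a uniformly ordered labeling.
   Context: $\mathbb N=\{0,1,2,\dots\}$; for integers $a\le b$, $[a,b]=\{x\in\mathbb N: a\le x\le b\}$. For integers $m_1,\dots,m_t\ge3$, $n_1,\dots,n_t\ge0$, the graph $C_{m_1,(n_1),\dots,m_t,(n_t)}$ has $m_1+\dots+m_t+n_1+\dots+n_t-(t-1)$ vertices and $m_1+\dots+m_t+n_1+\dots+n_t$ edges, and consists of $t$ cycles $C_{m_1},\dots,C_{m_t}$ (of lengths $m_i$) and $t$ paths $P_{n_1+1},\dots,P_{n_t+1}$ ($P_{n_i+1}$ has $n_i+1$ vertices) such that: the cycle $C_{m_1}$ has exactly one vertex in common with $P_{n_1+1}$; for each $i=1,\dots,t-1$ the path $P_{n_i+1}$ has one end vertex in common with $C_{m_i}$ and its other end vertex in common with $C_{m_{i+1}}$ (for $n_i=0$ these coincide); for each $i=2,\dots,t$ the cycle $C_{m_i}$ has one vertex in common with $P_{n_{i-1}+1}$ and one with $P_{n_i+1}$, and these two vertices are at distance $2$; $P_{n_t+1}$ has an end vertex on $C_{m_t}$; no other vertices are shared among cycles and paths. For a graph $G=(V,E)$ with $|E|=m'$ and $t'\in\mathbb N$, a labeling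 is an injective map $f\colon V\to[0,t']$; it induces $\tilde f(\{u,v\})=|f(u)-f(v)|$. $f$ is a $\overline{\rho}$-labeling if (a) $t'\ge 2m'$, (b) $\tilde f$ is injective, (c) there is no $i\in\{1,\dots,m'\}$ with both $i$ and $t'+1-i$ in $\operatorname{Im}\tilde f$. If $G$ is bipartite with vertex bipartition $\{A,B\}$, an $(A,B,t')$-uniformly ordered labeling is a $\overline{\rho}$-labeling $f\colon V\to[0,t']$ for which there is $\lambda\in\mathbb N$ with $f(a)\le\lambda$ for all $a\in A$ and $f(b)>\lambda$ for all $b\in B$. A uniformly ordered labeling of a bipartite graph $G$ with $m'$ edges is a labeling $f\colon V\to[0,2m']$ that is $(A,B,2m')$-uniformly ordered for some vertex bipartition $\{A,B\}$ of $G$. -}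

module Defs where

open import Data.Nat using (ℕ; zero; suc; _+_; _*_; _∸_; _≤_; _<_; ∣_-_∣)
open import Data.Nat.Divisibility using (_∣_)
open import Data.Bool using (Bool; true; false)
open import Data.List using (List; []; _∷_; _++_; map; length; [_])
open import Data.Nat.ListAction using (sum)
open import Data.List.Relation.Unary.All using (All)
open import Data.List.Relation.Unary.Unique.Propositional using (Unique)
open import Data.List.Membership.Propositional using (_∈_)
open import Data.Product using (_×_; _,_; proj₁; proj₂; Σ; ∃)
open import Data.Empty using (⊥)
open import Relation.Binary.PropositionalEquality using (_≡_; _≢_)

-- A finite graph with vertex set {0,…,N-1} given by a list of edges.
record Graph : Set where
  constructor mkGraph
  field
    nV    : ℕ
    edges : List (ℕ × ℕ)
open Graph public

chain : ℕ → ℕ → ℕ → List (ℕ × ℕ)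
chain a c zero    = []
chain a c (suc k) = (a , c) ∷ chain c (suc c) k

chainEnd : ℕ → ℕ → ℕ → ℕ
chainEnd a c zero    = a
chainEnd a c (suc k) = c + k

cycleE : ℕ → ℕ → ℕ → List (ℕ × ℕ)
cycleE e c m = chain e c (m ∸ 1) ++ [ (chainEnd e c (m ∸ 1) , e) ]

-- build e c bs : blocks (m_i , n_i); e = vertex of the current cycle where the
-- previous path arrives, c = first fresh vertex number.  The path leaving the
-- current cycle starts at c+1, which is at distance 2 from e on the cycle.
build : ℕ → ℕ → List (ℕ × ℕ) → List (ℕ × ℕ)
build e c [] = []
build e c ((m , n) ∷ []) =
  cycleE e c m ++ chain (suc c) (c + (m ∸ 1)) n
build e c ((m , n) ∷ (b ∷ bs)) =
  cycleE e c m ++ chain (suc c) (c + (m ∸ 1)) n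
    ++ build (chainEnd (suc c) (c + (m ∸ 1)) n) (c + (m ∸ 1) + n) (b ∷ bs)

-- The graph C_{m_1,(n_1),…,m_t,(n_t)} for the block list ((m_1,n_1),…,(m_t,n_t)).
-- Its vertex count is  1 + Σ (m_i - 1 + n_i) = Σ m_i + Σ n_i - (t-1).
Cgraph : List (ℕ × ℕ) → Graph
Cgraph bs = mkGraph (suc (sum (map (λ b → proj₁ b ∸ 1 + proj₂ b) bs))) (build 0 1 bs)

edgeLabels : (ℕ → ℕ) → List (ℕ × ℕ) → List ℕ
edgeLabels f = map (λ e → ∣ f (proj₁ e) - f (proj₂ e) ∣)

IsRhoBarLabeling : Graph → ℕ → (ℕ → ℕ) → Set
IsRhoBarLabeling G t' f =
  (2 * length (edges G) ≤ t')
  × (∀ u v → u < nV G → v < nV G → f u ≡ f v → u ≡ v)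
  × (∀ v → v < nV G → f v ≤ t')
  × Unique (edgeLabels f (edges G))
  × (∀ i → 1 ≤ i → i ≤ length (edges G) →
       i ∈ edgeLabels f (edges G) → (t' + 1 ∸ i) ∈ edgeLabels f (edges G) → ⊥)

-- a vertex bipartition {A,B} given by side : A = side⁻¹(true), B = side⁻¹(false)
IsBipartition : Graph → (ℕ → Bool) → Set
IsBipartition G side = All (λ e → side (proj₁ e) ≢ side (proj₂ e)) (edges G)

IsUniformlyOrdered : Graph → (ℕ → Bool) → ℕ → (ℕ → ℕ) → Set
IsUniformlyOrdered G side t' f =
  IsRhoBarLabeling G t' f
  × Σ ℕ (λ λ' → ∀ v → v < nV G →
       (side v ≡ true → f v ≤ λ') × (side v ≡ false → λ' < f v))

HasUniformlyOrderedLabeling : Graph → Set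
HasUniformlyOrderedLabeling G =
  Σ (ℕ → Bool) λ side → IsBipartition G side ×
    Σ (ℕ → ℕ) λ f → IsUniformlyOrdered G side (2 * length (edges G)) f

InnerBlockOK : ℕ × ℕ → Set
InnerBlockOK (m , n) = (3 ≤ m) × (4 ∣ m) × (2 ∣ n)

{-# OPTIONS --safe #-}
module Submission where

-- The labeling is built block by block, a block being a cycle together with the tail
-- leaving it.  If D edges precede a block with entry value E, its cycle is labelled, as
-- a closed walk from E, by a top value followed by two zigzags, and its tail by a zigzag
-- between a descending run of low and an ascending run of high values, so that the edge
-- labels of the block are exactly D+1, …, D+mᵢ+nᵢ.  The low values of a block lie in
-- [E′, E), E′ the entry value of the next block, and its high values lie above E + D and
-- below those of the next block.  Hence all vertex values are distinct, and every edge
-- joins a value ≤ L to a value > L, where L is the value of the first vertex: this gives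
-- the bipartition and the uniform order with λ = L.
-- When mₜ ≡ 2 (mod 4) the labels of the last cycle exceed the number M of edges and fill
-- up 1, …, M only after folding each label ℓ > M to 2M+1−ℓ.  Since condition (c) of a
-- ρ̄-labeling into [0, 2M] says precisely that the labels stay distinct under this
-- folding, the folded labels being a permutation of 1, …, M gives (b) and (c) at once.

open import Defs
open import Data.Nat using (ℕ; zero; suc; _+_; _*_; _∸_; _≤_; _<_; z≤n; s≤s; ∣_-_∣; _≤ᵇ_; ⌊_/2⌋; ⌈_/2⌉)
open import Data.Nat.Properties
open import Data.Nat.Tactic.RingSolver using (solve-∀)
open import Data.List using (List; []; _∷_; _++_; [_]; map; length; concatMap)
open import Data.Nat.ListAction using (sum)
open import Data.Nat.Divisibility using (_∣_; divides)
open import Data.List.Properties using (map-++; map-∘; ++-assoc; ++-identityʳ; length-++; length-map)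
open import Data.List.Relation.Unary.All as All using (All; []; _∷_)
import Data.List.Relation.Unary.All.Properties as AllP
open import Data.List.Relation.Unary.Unique.Propositional using (Unique)
open import Data.List.Relation.Unary.Unique.Propositional.Properties using (map⁻)
open import Data.List.Membership.Propositional using (_∈_)
open import Data.List.Relation.Unary.Any using (here; there)
open import Data.Empty using (⊥; ⊥-elim)
open import Data.List.Relation.Unary.AllPairs using ([]; _∷_)
open import Data.List.Relation.Binary.Permutation.Propositional
  using (_↭_; ↭-refl; ↭-sym; ↭-trans; ↭-prep; ↭-swap; ↭⇒↭ₛ; module PermutationReasoning)
open import Data.List.Relation.Binary.Permutation.Propositional.Properties
  using (++⁺; ++⁺ˡ; ++⁺ʳ; ++-comm; shift; ++-commutativeMonoid; All-resp-↭; ↭-length)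
import Data.List.Relation.Binary.Permutation.Setoid.Properties as Permutationₛ
open import Data.Product using (_×_; _,_; proj₁; proj₂; Σ)
import Data.Product as Product
open import Data.Bool using (Bool; true; false; not; if_then_else_)
open import Data.Bool.Properties using (not-¬; ¬-not; not-involutive; T-≡)
open import Data.Unit using (⊤; tt)
open import Function using (Equivalence; _∘_)
import Algebra.Solver.CommutativeMonoid as CommutativeMonoidSolver
open import Relation.Binary.PropositionalEquality
  using (_≡_; _≢_; refl; sym; trans; cong; cong₂; subst; subst₂; setoid; module ≡-Reasoning)

cong₃ : ∀ {A : Set} (f : ℕ → ℕ → ℕ → A) {a a′ b b′ c c′} →
  a ≡ a′ → b ≡ b′ → c ≡ c′ → f a b c ≡ f a′ b′ c′
cong₃ f refl refl refl = refl

≤-by : ∀ {a b} d → a + d ≡ b → a ≤ b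
≤-by {a} d refl = m≤m+n a d

Unique-resp-↭ : ∀ {xs ys} → xs ↭ ys → Unique xs → Unique ys
Unique-resp-↭ p = Permutationₛ.Unique-resp-↭ (setoid ℕ) (↭⇒↭ₛ p)

Unique-map⇒injectiveOn : ∀ (g : ℕ → ℕ) {xs x y} → Unique (map g xs) → x ∈ xs → y ∈ xs → g x ≡ g y → x ≡ y
Unique-map⇒injectiveOn g (_ ∷ _)    (here refl) (here refl) _  = refl
Unique-map⇒injectiveOn g (gx∉ ∷ _)  (here refl) (there y∈) eq = ⊥-elim (All.lookup (AllP.map⁻ gx∉) y∈ eq)
Unique-map⇒injectiveOn g (gy∉ ∷ _)  (there x∈) (here refl) eq = ⊥-elim (All.lookup (AllP.map⁻ gy∉) x∈ (sym eq))
Unique-map⇒injectiveOn g (_ ∷ uniq) (there x∈) (there y∈) eq = Unique-map⇒injectiveOn g uniq x∈ y∈ eq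

module ++-Solver = CommutativeMonoidSolver (++-commutativeMonoid {A = ℕ})

range : ℕ → ℕ → List ℕ
range b zero    = []
range b (suc c) = b ∷ range (suc b) c

rangeDesc : ℕ → ℕ → List ℕ
rangeDesc b zero    = []
rangeDesc b (suc c) = b + c ∷ rangeDesc b c

range-++ : ∀ {b b′} c d → b + c ≡ b′ → range b c ++ range b′ d ≡ range b (c + d)
range-++ {b} zero    d refl = cong (λ a → range a d) (+-identityʳ b)
range-++ {b} (suc c) d refl = cong (b ∷_) (range-++ c d (sym (+-suc b c)))

range-merge : ∀ {b b′} c d {rest} → b + c ≡ b′ → range b c ++ range b′ d ++ rest ≡ range b (c + d) ++ rest
range-merge c d {rest} eq = trans (sym (++-assoc (range _ c) (range _ d) rest)) (cong (_++ rest) (range-++ c d eq))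

rangeDesc↭range : ∀ b c → rangeDesc b c ↭ range b c
rangeDesc↭range b zero    = ↭-refl
rangeDesc↭range b (suc c) = begin
  b + c ∷ rangeDesc b c   ↭⟨ ↭-prep (b + c) (rangeDesc↭range b c) ⟩
  [ b + c ] ++ range b c  ↭⟨ ++-comm [ b + c ] (range b c) ⟩
  range b c ++ [ b + c ]  ≡⟨ range-++ c 1 refl ⟩
  range b (c + 1)         ≡⟨ cong (range b) (+-comm c 1) ⟩
  range b (suc c)         ∎
  where open PermutationReasoning

length-range : ∀ b c → length (range b c) ≡ c
length-range b zero    = refl
length-range b (suc c) = cong suc (length-range (suc b) c)

data IncreasingIn : ℕ → ℕ → List ℕ → Set where
  []  : ∀ {lo hi} → lo ≤ hi → IncreasingIn lo hi []
  _∷_ : ∀ {lo hi x xs} → lo ≤ x → IncreasingIn (suc x) hi xs → IncreasingIn lo hi (x ∷ xs)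

IncreasingIn-lower : ∀ {lo lo′ hi xs} → lo′ ≤ lo → IncreasingIn lo hi xs → IncreasingIn lo′ hi xs
IncreasingIn-lower lo′≤lo ([] lo≤hi) = [] (≤-trans lo′≤lo lo≤hi)
IncreasingIn-lower lo′≤lo (lo≤x ∷ xs) = ≤-trans lo′≤lo lo≤x ∷ xs

IncreasingIn-upper : ∀ {lo hi hi′ xs} → hi ≤ hi′ → IncreasingIn lo hi xs → IncreasingIn lo hi′ xs
IncreasingIn-upper hi≤hi′ ([] lo≤hi) = [] (≤-trans lo≤hi hi≤hi′)
IncreasingIn-upper hi≤hi′ (lo≤x ∷ xs) = lo≤x ∷ IncreasingIn-upper hi≤hi′ xs

IncreasingIn-++ : ∀ {a b c d xs ys} →
  IncreasingIn a b xs → b ≤ c → IncreasingIn c d ys → IncreasingIn a d (xs ++ ys)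
IncreasingIn-++ ([] a≤b) b≤c ys = IncreasingIn-lower (≤-trans a≤b b≤c) ys
IncreasingIn-++ (a≤x ∷ xs) b≤c ys = a≤x ∷ IncreasingIn-++ xs b≤c ys

IncreasingIn-range : ∀ b c → IncreasingIn b (b + c) (range b c)
IncreasingIn-range b zero    = [] (m≤m+n b 0)
IncreasingIn-range b (suc c) =
  ≤-refl ∷ subst (λ h → IncreasingIn (suc b) h (range (suc b) c)) (sym (+-suc b c)) (IncreasingIn-range (suc b) c)

IncreasingIn⇒All : ∀ {lo hi xs} → IncreasingIn lo hi xs → All (λ z → lo ≤ z × z < hi) xs
IncreasingIn⇒All ([] _)       = []
IncreasingIn⇒All (lo≤x ∷ xs) =
  (lo≤x , below xs) ∷ All.map (λ (x<z , z<hi) → ≤-trans lo≤x (<⇒≤ x<z) , z<hi) (IncreasingIn⇒All xs)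
  where
  below : ∀ {x hi ys} → IncreasingIn (suc x) hi ys → x < hi
  below ([] x<hi)  = x<hi
  below (x<y ∷ ys) = <-≤-trans x<y (<⇒≤ (below ys))

IncreasingIn⇒Unique : ∀ {lo hi xs} → IncreasingIn lo hi xs → Unique xs
IncreasingIn⇒Unique ([] _)      = []
IncreasingIn⇒Unique (_ ∷ xs) = All.map (λ (x<z , _) → <⇒≢ x<z) (IncreasingIn⇒All xs) ∷ IncreasingIn⇒Unique xs

record SplitsAround (lo L D hi : ℕ) (xs : List ℕ) : Set where
  constructor splitting
  field
    lows highs       : List ℕ
    ↭-lows++highs    : xs ↭ lows ++ highs
    lows-increasing  : IncreasingIn lo L lows
    highs-increasing : IncreasingIn (suc (L + D)) hi highs

SplitsAround-upper : ∀ {lo L D hi hi′ xs} → hi ≤ hi′ → SplitsAround lo L D hi xs → SplitsAround lo L D hi′ xs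
SplitsAround-upper hi≤hi′ (splitting lows highs p lows↑ highs↑) =
  splitting lows highs p lows↑ (IncreasingIn-upper hi≤hi′ highs↑)

SplitsAround-++ : ∀ {lo N L D D′ hi hi′ xs ys} →
  SplitsAround N L D hi xs → hi ≤ suc (N + D′) → SplitsAround lo N D′ hi′ ys →
  SplitsAround lo L D hi′ (xs ++ ys)
SplitsAround-++ (splitting lx hx xs↭ lx↑ hx↑) hi≤ (splitting ly hy ys↭ ly↑ hy↑) =
  splitting (ly ++ lx) (hx ++ hy) (↭-trans (++⁺ xs↭ ys↭) (regroup lx hx ly hy))
    (IncreasingIn-++ ly↑ ≤-refl lx↑) (IncreasingIn-++ hx↑ hi≤ hy↑)
  where
  open ++-Solver
  regroup : ∀ a b c d → (a ++ b) ++ (c ++ d) ↭ (c ++ a) ++ (b ++ d)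
  regroup = solve 4 (λ a b c d → (a ⊕ b) ⊕ (c ⊕ d) ⊜ (c ⊕ a) ⊕ (b ⊕ d)) ↭-refl

SplitsAround-insert : ∀ {lo L hi xs} → SplitsAround lo L 0 hi xs → Σ (List ℕ) λ ys → L ∷ xs ↭ ys × IncreasingIn lo hi ys
SplitsAround-insert {L = L} (splitting lows highs xs↭ lows↑ highs↑) =
  lows ++ L ∷ highs ,
  ↭-trans (↭-prep L xs↭) (↭-sym (shift L lows highs)) ,
  IncreasingIn-++ lows↑ ≤-refl (≤-refl ∷ subst (λ a → IncreasingIn (suc a) _ highs) (+-identityʳ L) highs↑)

walk : ℕ → List ℕ → List (ℕ × ℕ)
walk a []       = []
walk a (x ∷ xs) = (a , x) ∷ walk x xs

walkEnd : ℕ → List ℕ → ℕ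
walkEnd a []       = a
walkEnd a (x ∷ xs) = walkEnd x xs

walk-++ : ∀ a xs ys → walk a (xs ++ ys) ≡ walk a xs ++ walk (walkEnd a xs) ys
walk-++ a []       ys = refl
walk-++ a (x ∷ xs) ys = cong ((a , x) ∷_) (walk-++ x xs ys)

edgeLabel : ℕ × ℕ → ℕ
edgeLabel (u , v) = ∣ u - v ∣

walkLabels : ℕ → List ℕ → List ℕ
walkLabels a xs = map edgeLabel (walk a xs)

walkLabels-++ : ∀ a xs ys → walkLabels a (xs ++ ys) ≡ walkLabels a xs ++ walkLabels (walkEnd a xs) ys
walkLabels-++ a xs ys = trans (cong (map edgeLabel) (walk-++ a xs ys)) (map-++ edgeLabel (walk a xs) _)

distance : ∀ a b d → a + d ≡ b → ∣ a - b ∣ ≡ d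
distance a _ d refl = ∣m-m+n∣≡n a d

distance′ : ∀ a b d → b + d ≡ a → ∣ a - b ∣ ≡ d
distance′ a b d eq = trans (∣-∣-comm a b) (distance b a d eq)

-- The tail of a block leaves its cycle from the second vertex after the entry vertex
-- (see build); the junk value 0 for shorter cycles is excluded by HasExit.
exitOf : List ℕ → ℕ
exitOf (_ ∷ x ∷ _) = x
exitOf _           = 0

blockWalk : ℕ → List ℕ × List ℕ → List (ℕ × ℕ)
blockWalk e (cyc , tl) = walk e (cyc ++ [ e ]) ++ walk (exitOf cyc) tl

blocksWalk : ℕ → List (List ℕ × List ℕ) → List (ℕ × ℕ)
blocksWalk e []               = []
blocksWalk e ((cyc , tl) ∷ bs) = blockWalk e (cyc , tl) ++ blocksWalk (walkEnd (exitOf cyc) tl) bs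

shapeOf : List ℕ × List ℕ → ℕ × ℕ
shapeOf (cyc , tl) = suc (length cyc) , length tl

HasExit : List ℕ × List ℕ → Set
HasExit (cyc , _) = 2 ≤ length cyc

vertexValues : List (List ℕ × List ℕ) → List ℕ
vertexValues = concatMap (λ (cyc , tl) → cyc ++ tl)

Enumerates : (ℕ → ℕ) → ℕ → List ℕ → Set
Enumerates f c []       = ⊤
Enumerates f c (x ∷ xs) = f c ≡ x × Enumerates f (suc c) xs

Enumerates-++ : ∀ f c xs {ys} → Enumerates f c (xs ++ ys) → Enumerates f c xs × Enumerates f (c + length xs) ys
Enumerates-++ f c []       {ys} e        = tt , subst (λ c′ → Enumerates f c′ ys) (sym (+-identityʳ c)) e
Enumerates-++ f c (x ∷ xs) {ys} (fc , e) =
  (fc , proj₁ rest) , subst (λ c′ → Enumerates f c′ ys) (sym (+-suc c (length xs))) (proj₂ rest)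
  where
  rest = Enumerates-++ f (suc c) xs e

image : (ℕ → ℕ) → List (ℕ × ℕ) → List (ℕ × ℕ)
image f = map (Product.map f f)

chainEnd-suc : ∀ a c n → chainEnd a c (suc n) ≡ chainEnd c (suc c) n
chainEnd-suc a c zero    = +-identityʳ c
chainEnd-suc a c (suc n) = +-suc c n

image-chain : ∀ f a c xs → Enumerates f c xs → image f (chain a c (length xs)) ≡ walk (f a) xs
image-chain f a c []       _        = refl
image-chain f a c (x ∷ xs) (refl , e) = cong ((f a , f c) ∷_) (image-chain f c (suc c) xs e)

chainEnd-value : ∀ f a c xs → Enumerates f c xs → f (chainEnd a c (length xs)) ≡ walkEnd (f a) xs
chainEnd-value f a c []       _          = refl
chainEnd-value f a c (x ∷ xs) (refl , e) =
  trans (cong f (chainEnd-suc a c (length xs))) (chainEnd-value f c (suc c) xs e)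

image-cycleE : ∀ f e c xs → Enumerates f c xs → image f (cycleE e c (suc (length xs))) ≡ walk (f e) (xs ++ [ f e ])
image-cycleE f e c xs en = begin
  image f (chain e c (length xs) ++ [ (chainEnd e c (length xs) , e) ])
    ≡⟨ map-++ (Product.map f f) (chain e c (length xs)) _ ⟩
  image f (chain e c (length xs)) ++ [ (f (chainEnd e c (length xs)) , f e) ]
    ≡⟨ cong₂ (λ w a → w ++ [ (a , f e) ]) (image-chain f e c xs en) (chainEnd-value f e c xs en) ⟩
  walk (f e) xs ++ [ (walkEnd (f e) xs , f e) ]
    ≡⟨ walk-++ (f e) xs [ f e ] ⟨
  walk (f e) (xs ++ [ f e ]) ∎
  where open ≡-Reasoning

build-cons : ∀ e c m n rest → build e c ((m , n) ∷ rest) ≡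
  cycleE e c m ++ chain (suc c) (c + (m ∸ 1)) n ++ build (chainEnd (suc c) (c + (m ∸ 1)) n) (c + (m ∸ 1) + n) rest
build-cons e c m n []      = cong (cycleE e c m ++_) (sym (++-identityʳ _))
build-cons e c m n (_ ∷ _) = refl

image-build : ∀ f e c bs → All HasExit bs → Enumerates f c (vertexValues bs) →
  image f (build e c (map shapeOf bs)) ≡ blocksWalk (f e) bs
image-build f e c [] _ _ = refl
image-build f e c (([] , _) ∷ _) (() ∷ _) _
image-build f e c ((_ ∷ [] , _) ∷ _) (s≤s () ∷ _) _
image-build f e c ((a ∷ x ∷ cyc′ , tl) ∷ bs) (_ ∷ hs) en = begin
  image f (build e c (map shapeOf ((cyc , tl) ∷ bs)))
    ≡⟨ cong (image f) (build-cons e c _ _ (map shapeOf bs)) ⟩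
  image f (cycleE e c (suc (length cyc)) ++ chain (suc c) c′ (length tl) ++ build e′ (c′ + length tl) (map shapeOf bs))
    ≡⟨ map-++ (Product.map f f) (cycleE e c (suc (length cyc))) _ ⟩
  image f (cycleE e c (suc (length cyc))) ++ image f (chain (suc c) c′ (length tl) ++ build e′ (c′ + length tl) (map shapeOf bs))
    ≡⟨ cong (image f (cycleE e c (suc (length cyc))) ++_) (map-++ (Product.map f f) (chain (suc c) c′ (length tl)) _) ⟩
  image f (cycleE e c (suc (length cyc))) ++ image f (chain (suc c) c′ (length tl)) ++ image f (build e′ (c′ + length tl) (map shapeOf bs))
    ≡⟨ cong₂ _++_ (image-cycleE f e c cyc en-cyc) (cong₂ _++_ (image-chain f (suc c) c′ tl en-tl)
         (trans (image-build f e′ (c′ + length tl) bs hs en-rest)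
                (cong (λ v → blocksWalk v bs) (chainEnd-value f (suc c) c′ tl en-tl)))) ⟩
  walk (f e) (cyc ++ [ f e ]) ++ walk (f (suc c)) tl ++ blocksWalk (walkEnd (f (suc c)) tl) bs
    ≡⟨ cong (λ v → walk (f e) (cyc ++ [ f e ]) ++ walk v tl ++ blocksWalk (walkEnd v tl) bs) (proj₁ (proj₂ en-cyc)) ⟩
  walk (f e) (cyc ++ [ f e ]) ++ walk x tl ++ blocksWalk (walkEnd x tl) bs
    ≡⟨ ++-assoc (walk (f e) (cyc ++ [ f e ])) (walk x tl) _ ⟨
  blocksWalk (f e) ((cyc , tl) ∷ bs) ∎
  where
  open ≡-Reasoning
  cyc = a ∷ x ∷ cyc′
  c′ = c + length cyc
  e′ = chainEnd (suc c) c′ (length tl)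
  en-block = proj₁ (Enumerates-++ f c (cyc ++ tl) en)
  en-cyc = proj₁ (Enumerates-++ f c cyc en-block)
  en-tl = proj₂ (Enumerates-++ f c cyc en-block)
  en-rest : Enumerates f (c′ + length tl) (vertexValues bs)
  en-rest = subst (λ c″ → Enumerates f c″ (vertexValues bs))
    (trans (cong (c +_) (length-++ cyc)) (sym (+-assoc c (length cyc) (length tl))))
    (proj₂ (Enumerates-++ f c (cyc ++ tl) en))

vertexCount-shapes : ∀ bs → sum (map (λ b → proj₁ b ∸ 1 + proj₂ b) (map shapeOf bs)) ≡ length (vertexValues bs)
vertexCount-shapes []               = refl
vertexCount-shapes ((cyc , tl) ∷ bs) = sym (begin
  length ((cyc ++ tl) ++ vertexValues bs)         ≡⟨ length-++ (cyc ++ tl) ⟩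
  length (cyc ++ tl) + length (vertexValues bs)   ≡⟨ cong₂ _+_ (length-++ cyc) (sym (vertexCount-shapes bs)) ⟩
  length cyc + length tl + _                      ∎)
  where open ≡-Reasoning

valueAt : List ℕ → ℕ → ℕ
valueAt []       _       = 0
valueAt (x ∷ xs) zero    = x
valueAt (x ∷ xs) (suc v) = valueAt xs v

Enumerates-suc : ∀ g c xs → Enumerates (g ∘ suc) c xs → Enumerates g (suc c) xs
Enumerates-suc g c []       _        = tt
Enumerates-suc g c (x ∷ xs) (gx , e) = gx , Enumerates-suc g (suc c) xs e

valueAt-enumerates : ∀ xs → Enumerates (valueAt xs) 0 xs
valueAt-enumerates []       = tt
valueAt-enumerates (x ∷ xs) = refl , Enumerates-suc (valueAt (x ∷ xs)) 0 xs (valueAt-enumerates xs)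

valueAt-∈ : ∀ xs {v} → v < length xs → valueAt xs v ∈ xs
valueAt-∈ (x ∷ xs) {zero}  _         = here refl
valueAt-∈ (x ∷ xs) {suc v} (s≤s v<) = there (valueAt-∈ xs v<)

valueAt-injective : ∀ xs {u v} → Unique xs → u < length xs → v < length xs → valueAt xs u ≡ valueAt xs v → u ≡ v
valueAt-injective (x ∷ xs) {zero}  {zero}  _          _         _         _  = refl
valueAt-injective (x ∷ xs) {zero}  {suc v} (x∉ ∷ _)  _         (s≤s v<) eq = ⊥-elim (All.lookup x∉ (valueAt-∈ xs v<) eq)
valueAt-injective (x ∷ xs) {suc u} {zero}  (x∉ ∷ _)  (s≤s u<) _         eq = ⊥-elim (All.lookup x∉ (valueAt-∈ xs u<) (sym eq))
valueAt-injective (x ∷ xs) {suc u} {suc v} (_ ∷ uniq) (s≤s u<) (s≤s v<) eq = cong suc (valueAt-injective xs uniq u< v< eq)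

zig : ℕ → ℕ → ℕ → List ℕ
zig lo s zero    = []
zig lo s (suc c) = lo ∷ lo + suc (s + 2 * c) ∷ zig (suc lo) s c

zig-↭ : ∀ lo s c → zig lo s c ↭ range lo c ++ range (lo + s + c) c
zig-↭ lo s c = ↭-trans (zig-↭-desc lo s c) (++⁺ˡ (range lo c) (rangeDesc↭range (lo + s + c) c))
  where
  zig-↭-desc : ∀ lo s c → zig lo s c ↭ range lo c ++ rangeDesc (lo + s + c) c
  zig-↭-desc lo s zero    = ↭-refl
  zig-↭-desc lo s (suc c) = ↭-prep lo (begin
    hi ∷ zig (suc lo) s c                                 ↭⟨ ↭-prep hi (zig-↭-desc (suc lo) s c) ⟩
    hi ∷ range (suc lo) c ++ rangeDesc (suc lo + s + c) c  ↭⟨ shift hi (range (suc lo) c) _ ⟨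
    range (suc lo) c ++ hi ∷ rangeDesc (suc lo + s + c) c
      ≡⟨ cong₂ (λ t u → range (suc lo) c ++ t ∷ rangeDesc u c) (eq₁ lo s c) (eq₂ lo s c) ⟩
    range (suc lo) c ++ rangeDesc (lo + s + suc c) (suc c) ∎)
    where
    open PermutationReasoning
    hi = lo + suc (s + 2 * c)
    eq₁ : ∀ lo s c → lo + suc (s + 2 * c) ≡ lo + s + suc c + c
    eq₁ = solve-∀
    eq₂ : ∀ lo s c → suc lo + s + c ≡ lo + s + suc c
    eq₂ = solve-∀

tailValues : ℕ → ℕ → ℕ → List ℕ
tailValues b h zero          = []
tailValues b h (suc zero)    = [ h ]
tailValues b h (suc (suc n)) = h ∷ b + ⌊ n /2⌋ ∷ tailValues b (suc h) n

tailValues-↭ : ∀ b h n → tailValues b h n ↭ range b ⌊ n /2⌋ ++ range h ⌈ n /2⌉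
tailValues-↭ b h n = ↭-trans (tail-↭-desc h n) (++⁺ʳ (range h ⌈ n /2⌉) (rangeDesc↭range b ⌊ n /2⌋))
  where
  tail-↭-desc : ∀ h n → tailValues b h n ↭ rangeDesc b ⌊ n /2⌋ ++ range h ⌈ n /2⌉
  tail-↭-desc h zero          = ↭-refl
  tail-↭-desc h (suc zero)    = ↭-refl
  tail-↭-desc h (suc (suc n)) = begin
    h ∷ lo ∷ tailValues b (suc h) n  ↭⟨ ↭-prep h (↭-prep lo (tail-↭-desc (suc h) n)) ⟩
    h ∷ lo ∷ lows ++ highs           ↭⟨ ↭-swap h lo ↭-refl ⟩
    lo ∷ h ∷ lows ++ highs           ↭⟨ ↭-prep lo (shift h lows highs) ⟨
    lo ∷ lows ++ h ∷ highs           ∎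
    where
    open PermutationReasoning
    lo = b + ⌊ n /2⌋
    lows = rangeDesc b ⌊ n /2⌋
    highs = range (suc h) ⌈ n /2⌉

length-zig : ∀ lo s c → length (zig lo s c) ≡ 2 * c
length-zig lo s zero    = refl
length-zig lo s (suc c) = trans (cong (2 +_) (length-zig (suc lo) s c)) (sym (*-distribˡ-+ 2 1 c))

length-tailValues : ∀ b h n → length (tailValues b h n) ≡ n
length-tailValues b h zero          = refl
length-tailValues b h (suc zero)    = refl
length-tailValues b h (suc (suc n)) = cong (2 +_) (length-tailValues b (suc h) n)

rangeDesc-2+ : ∀ b c → rangeDesc b (2 * suc c) ≡ b + suc (2 * c) ∷ b + 2 * c ∷ rangeDesc b (2 * c)
rangeDesc-2+ b c = cong (rangeDesc b) (+-suc (suc c) (c + 0))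

zig-walkEnd : ∀ a lo s c → walkEnd a (zig lo s (suc c)) ≡ lo + c + suc s
zig-walkEnd a lo s zero    = eq lo s
  where
  eq : ∀ lo s → lo + suc (s + 2 * 0) ≡ lo + 0 + suc s
  eq = solve-∀
zig-walkEnd a lo s (suc c) = trans (zig-walkEnd (lo + suc (s + 2 * suc c)) (suc lo) s c) (cong (_+ suc s) (sym (+-suc lo c)))

zig-labels : ∀ a lo s c → walkLabels a (zig lo s (suc c)) ≡ ∣ a - lo ∣ ∷ rangeDesc (suc s) (suc (2 * c))
zig-labels a lo s zero    = cong (λ d → ∣ a - lo ∣ ∷ [ d ]) (distance lo _ (suc s + 0) (eq lo s))
  where
  eq : ∀ lo s → lo + (suc s + 0) ≡ lo + suc (s + 2 * 0)
  eq = solve-∀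
zig-labels a lo s (suc c) = cong (∣ a - lo ∣ ∷_) (begin
  ∣ lo - hi ∣ ∷ walkLabels hi (zig (suc lo) s (suc c))
    ≡⟨ cong (∣ lo - hi ∣ ∷_) (zig-labels hi (suc lo) s c) ⟩
  ∣ lo - hi ∣ ∷ ∣ hi - suc lo ∣ ∷ rangeDesc (suc s) (suc (2 * c))
    ≡⟨ cong₂ (λ d e → d ∷ e ∷ rangeDesc (suc s) (suc (2 * c)))
         (distance lo hi _ (eq₁ lo s c)) (distance′ hi (suc lo) _ (eq₂ lo s c)) ⟩
  suc s + suc (suc (2 * c)) ∷ suc s + suc (2 * c) ∷ rangeDesc (suc s) (suc (2 * c))
    ≡⟨ cong (λ c′ → rangeDesc (suc s) (suc c′)) (+-suc (suc c) (c + 0)) ⟨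
  rangeDesc (suc s) (suc (2 * suc c)) ∎)
  where
  open ≡-Reasoning
  hi = lo + suc (s + 2 * suc c)
  eq₁ : ∀ lo s c → lo + (suc s + suc (suc (2 * c))) ≡ lo + suc (s + 2 * suc c)
  eq₁ = solve-∀
  eq₂ : ∀ lo s c → suc lo + (suc s + suc (2 * c)) ≡ lo + suc (s + 2 * suc c)
  eq₂ = solve-∀

zig-closed-labels : ∀ a lo s c e → lo + c ≡ e → walkLabels a (zig lo s c ++ [ e ]) ≡ ∣ a - lo ∣ ∷ rangeDesc s (2 * c)
zig-closed-labels a lo s zero    e refl = cong (λ x → [ ∣ a - x ∣ ]) (+-identityʳ lo)
zig-closed-labels a lo s (suc c) e refl = cong (∣ a - lo ∣ ∷_) (begin
  ∣ lo - hi ∣ ∷ walkLabels hi (zig (suc lo) s c ++ [ lo + suc c ])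
    ≡⟨ cong (∣ lo - hi ∣ ∷_) (zig-closed-labels hi (suc lo) s c _ (sym (+-suc lo c))) ⟩
  ∣ lo - hi ∣ ∷ ∣ hi - suc lo ∣ ∷ rangeDesc s (2 * c)
    ≡⟨ cong₂ (λ d e → d ∷ e ∷ rangeDesc s (2 * c))
         (distance lo hi _ (eq₁ lo s c)) (distance′ hi (suc lo) _ (eq₂ lo s c)) ⟩
  s + suc (2 * c) ∷ s + 2 * c ∷ rangeDesc s (2 * c)
    ≡⟨ rangeDesc-2+ s c ⟨
  rangeDesc s (2 * suc c) ∎)
  where
  open ≡-Reasoning
  hi = lo + suc (s + 2 * c)
  eq₁ : ∀ lo s c → lo + (s + suc (2 * c)) ≡ lo + suc (s + 2 * c)
  eq₁ = solve-∀
  eq₂ : ∀ lo s c → suc lo + (s + 2 * c) ≡ lo + suc (s + 2 * c)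
  eq₂ = solve-∀

tailValues-labels : ∀ b h n d → b + ⌊ n /2⌋ + d ≡ h → walkLabels (b + ⌊ n /2⌋) (tailValues b h n) ≡ range d n
tailValues-labels b h zero          d eq = refl
tailValues-labels b h (suc zero)    d eq = cong [_] (distance (b + 0) h d eq)
tailValues-labels b h (suc (suc n)) d refl = cong₂ _∷_ (distance (b + suc ⌊ n /2⌋) _ d refl)
  (cong₂ _∷_ (distance′ _ (b + ⌊ n /2⌋) (suc d) (eq₁ b ⌊ n /2⌋ d)) (tailValues-labels b _ n (suc (suc d)) (eq₂ b ⌊ n /2⌋ d)))
  where
  eq₁ : ∀ b t d → b + t + suc d ≡ b + suc t + d
  eq₁ = solve-∀
  eq₂ : ∀ b t d → b + t + suc (suc d) ≡ suc (b + suc t + d)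
  eq₂ = solve-∀

tailValues-walkEnd : ∀ b h q → walkEnd (b + ⌊ q * 2 /2⌋) (tailValues b h (q * 2)) ≡ b
tailValues-walkEnd b h zero    = +-identityʳ b
tailValues-walkEnd b h (suc q) = tailValues-walkEnd b (suc h) q

Alternating : ℕ → Bool → List ℕ → Set
Alternating L s []       = ⊤
Alternating L s (x ∷ xs) = (x ≤ᵇ L) ≡ s × Alternating L (not s) xs

Crosses : ℕ → ℕ × ℕ → Set
Crosses L (u , v) = (u ≤ᵇ L) ≢ (v ≤ᵇ L)

walk-crosses : ∀ {L s} a xs → (a ≤ᵇ L) ≡ not s → Alternating L s xs → All (Crosses L) (walk a xs)
walk-crosses         a []       _      _              = []
walk-crosses {L} {s} a (x ∷ xs) a-side (x-side , alt) =
  (λ same → not-¬ x-side (trans (sym same) a-side))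
  ∷ walk-crosses x xs (trans x-side (sym (not-involutive s))) alt

≤⇒≤ᵇ≡true : ∀ {z L} → z ≤ L → (z ≤ᵇ L) ≡ true
≤⇒≤ᵇ≡true z≤L = Equivalence.to T-≡ (≤⇒≤ᵇ z≤L)

>⇒≤ᵇ≡false : ∀ {z L} → L < z → (z ≤ᵇ L) ≡ false
>⇒≤ᵇ≡false {z} {L} L<z = ¬-not (λ z≤ᵇL → <⇒≱ L<z (≤ᵇ⇒≤ z L (Equivalence.from T-≡ z≤ᵇL)))

zig-alternating : ∀ {L} lo s c ys → lo + c ≤ suc L → L < lo + s + c →
  Alternating L true ys → Alternating L true (zig lo s c ++ ys)
zig-alternating lo s zero    ys _ _ alt = alt
zig-alternating {L} lo s (suc c) ys lows highs alt =
  ≤⇒≤ᵇ≡true (≤-trans (m≤m+n lo c) (≤-pred lows′)) ,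
  >⇒≤ᵇ≡false (<-≤-trans highs (≤-by c (eq₁ lo s c))) ,
  zig-alternating (suc lo) s c ys lows′ (subst (L <_) (eq₂ lo s c) highs) alt
  where
  lows′ : suc lo + c ≤ suc L
  lows′ = subst (_≤ suc L) (+-suc lo c) lows
  eq₁ : ∀ lo s c → lo + s + suc c + c ≡ lo + suc (s + 2 * c)
  eq₁ = solve-∀
  eq₂ : ∀ lo s c → lo + s + suc c ≡ suc lo + s + c
  eq₂ = solve-∀

tailValues-alternating : ∀ {L} b h n → b + ⌊ n /2⌋ ≤ L → L < h → Alternating L false (tailValues b h n)
tailValues-alternating b h zero          _    _    = tt
tailValues-alternating b h (suc zero)    _    L<h = >⇒≤ᵇ≡false L<h , tt
tailValues-alternating b h (suc (suc n)) lows L<h =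
  >⇒≤ᵇ≡false L<h , ≤⇒≤ᵇ≡true lows′ , tailValues-alternating b (suc h) n lows′ (m<n⇒m<1+n L<h)
  where
  lows′ = ≤-trans (+-monoʳ-≤ b (n≤1+n ⌊ n /2⌋)) lows

record Block : Set where
  constructor block
  field
    top s₁ k lo₂ s₂ c₂ base start len : ℕ

  exit : ℕ
  exit = base + ⌊ len /2⌋

  cycle : List ℕ
  cycle = top ∷ zig exit s₁ (suc k) ++ zig lo₂ s₂ c₂

  tail : List ℕ
  tail = tailValues base start len

  values : List ℕ × List ℕ
  values = cycle , tail

  lows highs : List ℕ
  lows  = range base ⌊ len /2⌋ ++ range exit (suc k) ++ range lo₂ c₂
  highs = top ∷ range (lo₂ + s₂ + c₂) c₂ ++ range (exit + s₁ + suc k) (suc k) ++ range start ⌈ len /2⌉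

  ↭-lows++highs : cycle ++ tail ↭ lows ++ highs
  ↭-lows++highs = ↭-trans
    (++⁺ (↭-prep top (++⁺ (zig-↭ exit s₁ (suc k)) (zig-↭ lo₂ s₂ c₂))) (tailValues-↭ base start len))
    (regroup [ top ] (range exit (suc k)) (range (exit + s₁ + suc k) (suc k)) (range lo₂ c₂) (range (lo₂ + s₂ + c₂) c₂)
             (range base ⌊ len /2⌋) (range start ⌈ len /2⌉))
    where
    open ++-Solver
    regroup : ∀ t l₁ h₁ l₂ h₂ lₜ hₜ →
      (t ++ (l₁ ++ h₁) ++ (l₂ ++ h₂)) ++ (lₜ ++ hₜ) ↭ (lₜ ++ l₁ ++ l₂) ++ (t ++ h₂ ++ h₁ ++ hₜ)
    regroup = solve 7 (λ t l₁ h₁ l₂ h₂ lₜ hₜ →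
      (t ⊕ (l₁ ⊕ h₁) ⊕ (l₂ ⊕ h₂)) ⊕ (lₜ ⊕ hₜ) ⊜ (lₜ ⊕ l₁ ⊕ l₂) ⊕ (t ⊕ h₂ ⊕ h₁ ⊕ hₜ)) ↭-refl

record Layout (E D : ℕ) (B : Block) : Set where
  open Block B
  field
    lows-gap    : exit + suc k ≤ lo₂
    closes      : lo₂ + c₂ ≡ E
    top-above   : suc (E + D) ≤ top
    highs-gap₂  : suc top ≤ lo₂ + s₂ + c₂
    highs-gap₁  : lo₂ + s₂ + c₂ + c₂ ≤ exit + s₁ + suc k
    highs-gapₜ  : exit + s₁ + suc k + suc k ≤ start

module _ {E D : ℕ} {B : Block} (layout : Layout E D B) where
  open Block B
  open Layout layout

  Layout-splits : SplitsAround base E D (start + ⌈ len /2⌉) (cycle ++ tail)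
  Layout-splits = splitting lows highs ↭-lows++highs
    (IncreasingIn-++ (IncreasingIn-range base ⌊ len /2⌋) ≤-refl
      (IncreasingIn-++ (IncreasingIn-range exit (suc k)) lows-gap
        (IncreasingIn-upper (≤-reflexive closes) (IncreasingIn-range lo₂ c₂))))
    (top-above ∷ IncreasingIn-lower highs-gap₂
      (IncreasingIn-++ (IncreasingIn-range (lo₂ + s₂ + c₂) c₂) highs-gap₁
        (IncreasingIn-++ (IncreasingIn-range (exit + s₁ + suc k) (suc k)) highs-gapₜ
          (IncreasingIn-range start ⌈ len /2⌉))))

  Layout-crosses : ∀ {L} → E ≤ L → L ≤ E + D → All (Crosses L) (blockWalk E values)
  Layout-crosses {L} E≤L L≤E+D = AllP.++⁺
    (walk-crosses E (cycle ++ [ E ]) (≤⇒≤ᵇ≡true E≤L)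
      (>⇒≤ᵇ≡false L<top , subst (Alternating L true) (sym (++-assoc (zig exit s₁ (suc k)) (zig lo₂ s₂ c₂) [ E ]))
        (zig-alternating exit s₁ (suc k) _ (≤-trans zig₁-lows (n≤1+n L)) L<zig₁-highs
          (zig-alternating lo₂ s₂ c₂ [ E ] (≤-trans (≤-reflexive closes) (≤-trans E≤L (n≤1+n L))) L<zig₂-highs
            (≤⇒≤ᵇ≡true E≤L , tt)))))
    (walk-crosses exit tail (≤⇒≤ᵇ≡true (≤-trans (m≤m+n exit (suc k)) zig₁-lows))
      (tailValues-alternating base start len (≤-trans (m≤m+n exit (suc k)) zig₁-lows)
        (<-≤-trans L<zig₁-highs (≤-trans (m≤m+n _ (suc k)) highs-gapₜ))))
    where
    L<top : L < top
    L<top = <-≤-trans (s≤s L≤E+D) top-above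
    L<zig₂-highs : L < lo₂ + s₂ + c₂
    L<zig₂-highs = <-≤-trans (m<n⇒m<1+n L<top) highs-gap₂
    L<zig₁-highs : L < exit + s₁ + suc k
    L<zig₁-highs = <-≤-trans L<zig₂-highs (≤-trans (m≤m+n _ c₂) highs-gap₁)
    zig₁-lows : exit + suc k ≤ L
    zig₁-lows = ≤-trans lows-gap (≤-trans (m≤m+n lo₂ c₂) (≤-trans (≤-reflexive closes) E≤L))

Block-cycle-labels : ∀ B E → let open Block B in lo₂ + c₂ ≡ E →
  walkLabels E (cycle ++ [ E ])
    ≡ ∣ E - top ∣ ∷ ∣ top - exit ∣ ∷ rangeDesc (suc s₁) (suc (2 * k))
      ++ ∣ exit + k + suc s₁ - lo₂ ∣ ∷ rangeDesc s₂ (2 * c₂)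
Block-cycle-labels B E closes = cong (∣ E - top ∣ ∷_) (begin
  walkLabels top ((zig₁ ++ zig₂) ++ [ E ])
    ≡⟨ cong (walkLabels top) (++-assoc zig₁ zig₂ [ E ]) ⟩
  walkLabels top (zig₁ ++ zig₂ ++ [ E ])
    ≡⟨ walkLabels-++ top zig₁ (zig₂ ++ [ E ]) ⟩
  walkLabels top zig₁ ++ walkLabels (walkEnd top zig₁) (zig₂ ++ [ E ])
    ≡⟨ cong₂ _++_ (zig-labels top exit s₁ k) (cong (λ a → walkLabels a (zig₂ ++ [ E ])) (zig-walkEnd top exit s₁ k)) ⟩
  (∣ top - exit ∣ ∷ rangeDesc (suc s₁) (suc (2 * k))) ++ walkLabels (exit + k + suc s₁) (zig₂ ++ [ E ])
    ≡⟨ cong ((∣ top - exit ∣ ∷ rangeDesc (suc s₁) (suc (2 * k))) ++_) (zig-closed-labels _ lo₂ s₂ c₂ E closes) ⟩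
  ∣ top - exit ∣ ∷ rangeDesc (suc s₁) (suc (2 * k)) ++ ∣ exit + k + suc s₁ - lo₂ ∣ ∷ rangeDesc s₂ (2 * c₂) ∎)
  where
  open Block B
  open ≡-Reasoning
  zig₁ = zig exit s₁ (suc k)
  zig₂ = zig lo₂ s₂ c₂

Block-labels : ∀ B E d → let open Block B in lo₂ + c₂ ≡ E → exit + d ≡ start →
  map edgeLabel (blockWalk E values)
    ≡ (∣ E - top ∣ ∷ ∣ top - exit ∣ ∷ rangeDesc (suc s₁) (suc (2 * k))
        ++ ∣ exit + k + suc s₁ - lo₂ ∣ ∷ rangeDesc s₂ (2 * c₂))
      ++ range d len
Block-labels B E d closes tail-start =
  trans (map-++ edgeLabel (walk E (cycle ++ [ E ])) (walk exit tail))
        (cong₂ _++_ (Block-cycle-labels B E closes) (tailValues-labels base start len d tail-start))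
  where open Block B

Block-shape : ∀ B → let open Block B in shapeOf values ≡ (2 + (2 * suc k + 2 * c₂) , len)
Block-shape B = cong₂ _,_
  (cong (2 +_) (trans (length-++ (zig exit s₁ (suc k))) (cong₂ _+_ (length-zig exit s₁ (suc k)) (length-zig lo₂ s₂ c₂))))
  (length-tailValues base start len)
  where open Block B

Block-hasExit : ∀ B → HasExit (Block.values B)
Block-hasExit B = s≤s (s≤s z≤n)

fold : ℕ → ℕ → ℕ
fold M L = if L ≤ᵇ M then L else 2 * M + 1 ∸ L

fold-≤ : ∀ {M L} → L ≤ M → fold M L ≡ L
fold-≤ L≤M rewrite ≤⇒≤ᵇ≡true L≤M = refl

fold-> : ∀ {M L} d → M < L → L + d ≡ 2 * M + 1 → fold M L ≡ d
fold-> {M} {L} d M<L eq rewrite >⇒≤ᵇ≡false M<L = trans (cong (_∸ L) (sym eq)) (m+n∸m≡n L d)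

map-fold-≤ : ∀ {M xs} → All (_≤ M) xs → map (fold M) xs ≡ xs
map-fold-≤ []            = refl
map-fold-≤ (x≤M ∷ xs≤M) = cong₂ _∷_ (fold-≤ x≤M) (map-fold-≤ xs≤M)

fold-rangeDesc : ∀ M b c → b + c ≡ M → map (fold M) (rangeDesc (suc (suc M)) c) ≡ range b c
fold-rangeDesc M b zero    _    = refl
fold-rangeDesc _ b (suc c) refl = cong₂ _∷_
  (fold-> b (s≤s (≤-trans (n≤1+n _) (m≤m+n _ c))) (eq b c))
  (fold-rangeDesc _ (suc b) c (sym (+-suc b c)))
  where
  eq : ∀ b c → suc (suc (b + suc c)) + c + b ≡ 2 * (b + suc c) + 1
  eq = solve-∀

fold-range : ∀ M D B n → B + n + D ≡ 2 * M + 1 → D + n ≤ M → map (fold M) (range B n) ≡ rangeDesc (suc D) n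
fold-range M D B zero    _  _      = refl
fold-range M D B (suc n) eq D+n≤M = cong₂ _∷_
  (fold-> (suc D + n) M<B (trans (eq₁ B n D) eq))
  (fold-range M D (suc B) n (trans (eq₂ B n D) eq) (≤-trans (+-monoʳ-≤ D (n≤1+n n)) D+n≤M))
  where
  eq₁ : ∀ B n D → B + (suc D + n) ≡ B + suc n + D
  eq₁ = solve-∀
  eq₂ : ∀ B n D → suc B + n + D ≡ B + suc n + D
  eq₂ = solve-∀
  M<B : M < B
  M<B = +-cancelʳ-< (suc D + n) M B (begin-strict
    M + (suc D + n)      ≡⟨ cong (M +_) (+-suc D n) ⟨
    M + (D + suc n)      ≤⟨ +-monoʳ-≤ M D+n≤M ⟩
    M + M                <⟨ n<1+n (M + M) ⟩
    suc (M + M)          ≡⟨ eq₃ M ⟩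
    2 * M + 1            ≡⟨ trans (eq₁ B n D) eq ⟨
    B + (suc D + n)      ∎)
    where
    open ≤-Reasoning
    eq₃ : ∀ M → suc (M + M) ≡ 2 * M + 1
    eq₃ = solve-∀

map-fold-rangeDesc-≤ : ∀ {M} b c → b + c ≤ suc M → map (fold M) (rangeDesc b c) ≡ rangeDesc b c
map-fold-rangeDesc-≤ b c bound = map-fold-≤ (All-resp-↭ (↭-sym (rangeDesc↭range b c))
  (All.map (λ (_ , z<b+c) → ≤-pred (<-≤-trans z<b+c bound)) (IncreasingIn⇒All (IncreasingIn-range b c))))

fold-↭-range : ∀ {xs D s M} → xs ↭ range (suc D) s → D + s ≤ M → map (fold M) xs ↭ range (suc D) s
fold-↭-range {xs} {D} {s} xs↭ D+s≤M = subst (_↭ range (suc D) s) (sym (map-fold-≤ (All-resp-↭ (↭-sym xs↭)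
  (All.map (λ (_ , z<) → ≤-pred (<-≤-trans z< (s≤s D+s≤M))) (IncreasingIn⇒All (IncreasingIn-range (suc D) s)))))) xs↭

fold-complement : ∀ {m i} → i ≤ m → fold m (2 * m + 1 ∸ i) ≡ i × m < 2 * m + 1 ∸ i
fold-complement {m} {i} i≤m = fold-> i m<j (m∸n+n≡m (≤-trans i≤m m≤2m+1)) , m<j
  where
  m≤2m+1 : m ≤ 2 * m + 1
  m≤2m+1 = ≤-by (m + 1) (eq m)
    where
    eq : ∀ m → m + (m + 1) ≡ 2 * m + 1
    eq = solve-∀
  m<j : m < 2 * m + 1 ∸ i
  m<j = ≤-trans (≤-reflexive (sym (trans (cong (_∸ m) (eq m)) (m+n∸m≡n m (suc m))))) (∸-monoʳ-≤ (2 * m + 1) i≤m)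
    where
    eq : ∀ m → 2 * m + 1 ≡ m + suc m
    eq = solve-∀

folded-labels⇒uniformlyOrdered : ∀ G f L → let m = length (edges G) in
  (∀ u v → u < nV G → v < nV G → f u ≡ f v → u ≡ v) →
  (∀ v → v < nV G → f v ≤ 2 * m) →
  map (fold m) (edgeLabels f (edges G)) ↭ range 1 m →
  All (Crosses L) (image f (edges G)) →
  HasUniformlyOrderedLabeling G
folded-labels⇒uniformlyOrdered G f L injective bounded folded↭ crosses =
  side , AllP.map⁻ crosses , f , (≤-refl , injective , bounded , map⁻ folded-unique , no-complements) , L , ordered
  where
  m = length (edges G)
  side : ℕ → Bool
  side v = f v ≤ᵇ L
  folded-unique : Unique (map (fold m) (edgeLabels f (edges G)))
  folded-unique = Unique-resp-↭ (↭-sym folded↭) (IncreasingIn⇒Unique (IncreasingIn-range 1 m))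
  no-complements : ∀ i → 1 ≤ i → i ≤ m → i ∈ edgeLabels f (edges G) → 2 * m + 1 ∸ i ∈ edgeLabels f (edges G) → ⊥
  no-complements i _ i≤m i∈ j∈ =
    <⇒≢ (≤-<-trans i≤m (proj₂ (fold-complement i≤m)))
      (Unique-map⇒injectiveOn (fold m) folded-unique i∈ j∈ (trans (fold-≤ i≤m) (sym (proj₁ (fold-complement i≤m)))))
  ordered : ∀ v → v < nV G → (side v ≡ true → f v ≤ L) × (side v ≡ false → L < f v)
  ordered v _ = (λ low-side → ≤ᵇ⇒≤ (f v) L (Equivalence.from T-≡ low-side))
              , (λ high-side → ≰⇒> (λ fv≤L → not-¬ (≤⇒≤ᵇ≡true fv≤L) high-side))

⌊n/2⌋+c+⌈n/2⌉ : ∀ a n c → a + ⌊ n /2⌋ + c + ⌈ n /2⌉ ≡ a + n + c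
⌊n/2⌋+c+⌈n/2⌉ a n c = trans (eq a ⌊ n /2⌋ c ⌈ n /2⌉) (cong (λ m → a + m + c) (⌊n/2⌋+⌈n/2⌉≡n n))
  where
  eq : ∀ a t c u → a + t + c + u ≡ a + (t + u) + c
  eq = solve-∀

evenBlock : (b n D k : ℕ) → Block
evenBlock b n D k =
  block (x + suc (D + 2 * suc k)) (suc (D + 2 * suc k)) k (x + suc (suc k)) (2 + D) k b (x + suc (D + 4 * suc k)) n
  where
  x = b + ⌊ n /2⌋

evenEntry : ℕ → ℕ → ℕ → ℕ
evenEntry b n k = b + ⌊ n /2⌋ + 2 * suc k

evenLayout : ∀ b n D k → Layout (evenEntry b n k) D (evenBlock b n D k)
evenLayout b n D k = record
  { lows-gap   = +-monoʳ-≤ x (n≤1+n (suc k))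
  ; closes     = eq₁ x k
  ; top-above  = ≤-reflexive (eq₂ x D k)
  ; highs-gap₂ = ≤-reflexive (eq₃ x D k)
  ; highs-gap₁ = ≤-reflexive (eq₄ x D k)
  ; highs-gapₜ = ≤-reflexive (eq₅ x D k)
  }
  where
  x = b + ⌊ n /2⌋
  eq₁ : ∀ x k → x + suc (suc k) + k ≡ x + 2 * suc k
  eq₁ = solve-∀
  eq₂ : ∀ x D k → suc (x + 2 * suc k + D) ≡ x + suc (D + 2 * suc k)
  eq₂ = solve-∀
  eq₃ : ∀ x D k → suc (x + suc (D + 2 * suc k)) ≡ x + suc (suc k) + (2 + D) + k
  eq₃ = solve-∀
  eq₄ : ∀ x D k → x + suc (suc k) + (2 + D) + k + k ≡ x + suc (D + 2 * suc k) + suc k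
  eq₄ = solve-∀
  eq₅ : ∀ x D k → x + suc (D + 2 * suc k) + suc k + suc k ≡ x + suc (D + 4 * suc k)
  eq₅ = solve-∀

even-ranges-consecutive : ∀ D k n → let s₁ = suc (D + 2 * suc k) in
  range (suc D) 1 ++ range (2 + D) (2 * k) ++ range (D + 2 * suc k) 1 ++ range s₁ 1
    ++ range (suc s₁) (suc (2 * k)) ++ range (suc (D + 4 * suc k)) n
  ≡ range (suc D) (4 + k * 4 + n)
even-ranges-consecutive D k n = begin
  range (suc D) 1 ++ range (2 + D) (2 * k) ++ range (D + 2 * suc k) 1 ++ range (suc (D + 2 * suc k)) 1
    ++ range (suc (suc (D + 2 * suc k))) (suc (2 * k)) ++ range (suc (D + 4 * suc k)) n
    ≡⟨ range-merge 1 (2 * k) (+-comm (suc D) 1) ⟩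
  _ ≡⟨ range-merge (1 + 2 * k) 1 (eq₁ D k) ⟩
  _ ≡⟨ range-merge (1 + 2 * k + 1) 1 (eq₂ D k) ⟩
  _ ≡⟨ range-merge (1 + 2 * k + 1 + 1) (suc (2 * k)) (eq₃ D k) ⟩
  range (suc D) (1 + 2 * k + 1 + 1 + suc (2 * k)) ++ range (suc (D + 4 * suc k)) n
    ≡⟨ range-++ (1 + 2 * k + 1 + 1 + suc (2 * k)) n (eq₄ D k) ⟩
  range (suc D) (1 + 2 * k + 1 + 1 + suc (2 * k) + n)
    ≡⟨ cong (range (suc D)) (eq₅ k n) ⟩
  range (suc D) (4 + k * 4 + n) ∎
  where
  open ≡-Reasoning
  eq₁ : ∀ D k → suc D + (1 + 2 * k) ≡ D + 2 * suc k
  eq₁ = solve-∀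
  eq₂ : ∀ D k → suc D + (1 + 2 * k + 1) ≡ suc (D + 2 * suc k)
  eq₂ = solve-∀
  eq₃ : ∀ D k → suc D + (1 + 2 * k + 1 + 1) ≡ suc (suc (D + 2 * suc k))
  eq₃ = solve-∀
  eq₄ : ∀ D k → suc D + (1 + 2 * k + 1 + 1 + suc (2 * k)) ≡ suc (D + 4 * suc k)
  eq₄ = solve-∀
  eq₅ : ∀ k n → 1 + 2 * k + 1 + 1 + suc (2 * k) + n ≡ 4 + k * 4 + n
  eq₅ = solve-∀

evenBlock-raw-labels : ∀ b n D k → let s₁ = suc (D + 2 * suc k) in
  map edgeLabel (blockWalk (evenEntry b n k) (Block.values (evenBlock b n D k)))
    ≡ (suc D ∷ s₁ ∷ rangeDesc (suc s₁) (suc (2 * k)) ++ D + 2 * suc k ∷ rangeDesc (2 + D) (2 * k)) ++ range (suc (D + 4 * suc k)) n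
evenBlock-raw-labels b n D k = trans (Block-labels B E _ (Layout.closes (evenLayout b n D k)) refl)
  (cong₃ (λ d₁ d₂ d₃ → (d₁ ∷ d₂ ∷ rangeDesc (suc s₁) (suc (2 * k)) ++ d₃ ∷ rangeDesc (2 + D) (2 * k))
                       ++ range (suc (D + 4 * suc k)) n)
     (distance E top (suc D) (eq₁ x D k)) (distance′ top x s₁ refl) (distance′ _ lo₂ (D + 2 * suc k) (eq₂ x D k)))
  where
  B = evenBlock b n D k
  open Block B using (top; lo₂)
  x = b + ⌊ n /2⌋
  E = evenEntry b n k
  s₁ = suc (D + 2 * suc k)
  eq₁ : ∀ x D k → x + 2 * suc k + suc D ≡ x + suc (D + 2 * suc k)
  eq₁ = solve-∀
  eq₂ : ∀ x D k → x + suc (suc k) + (D + 2 * suc k) ≡ x + k + suc (suc (D + 2 * suc k))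
  eq₂ = solve-∀

evenBlock-labels : ∀ b n D k →
  map edgeLabel (blockWalk (evenEntry b n k) (Block.values (evenBlock b n D k))) ↭ range (suc D) (4 + k * 4 + n)
evenBlock-labels b n D k = begin
  map edgeLabel (blockWalk (evenEntry b n k) (Block.values (evenBlock b n D k)))
    ≡⟨ evenBlock-raw-labels b n D k ⟩
  ([ suc D ] ++ [ s₁ ] ++ rangeDesc (suc s₁) (suc (2 * k)) ++ [ D + 2 * suc k ] ++ rangeDesc (2 + D) (2 * k)) ++ T
    ↭⟨ ++⁺ʳ T (++⁺ˡ (suc D ∷ s₁ ∷ []) (++⁺ (rangeDesc↭range (suc s₁) (suc (2 * k)))
         (↭-prep (D + 2 * suc k) (rangeDesc↭range (2 + D) (2 * k))))) ⟩
  ([ suc D ] ++ [ s₁ ] ++ range (suc s₁) (suc (2 * k)) ++ [ D + 2 * suc k ] ++ range (2 + D) (2 * k)) ++ T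
    ↭⟨ regroup [ suc D ] [ s₁ ] (range (suc s₁) (suc (2 * k))) [ D + 2 * suc k ] (range (2 + D) (2 * k)) T ⟩
  range (suc D) 1 ++ range (2 + D) (2 * k) ++ range (D + 2 * suc k) 1 ++ range s₁ 1 ++ range (suc s₁) (suc (2 * k)) ++ T
    ≡⟨ even-ranges-consecutive D k n ⟩
  range (suc D) (4 + k * 4 + n) ∎
  where
  open PermutationReasoning
  s₁ = suc (D + 2 * suc k)
  T = range (suc (D + 4 * suc k)) n
  regroup : ∀ a b X c Y T → (a ++ b ++ X ++ c ++ Y) ++ T ↭ a ++ Y ++ c ++ b ++ X ++ T
  regroup = solve 6 (λ a b X c Y T → (a ⊕ b ⊕ X ⊕ c ⊕ Y) ⊕ T ⊜ a ⊕ Y ⊕ c ⊕ b ⊕ X ⊕ T) ↭-refl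
    where open ++-Solver

-- Only used as the last block, so M is the number of edges of the whole graph.
oddBlock : (n D k : ℕ) → Block
oddBlock n D k =
  block (x + M) (suc M) k (x + suc (3 * suc k)) (2 + (D + n)) (suc k) 0 (x + (M + (3 + 4 * suc k))) n
  where
  x = ⌊ n /2⌋
  M = D + (6 + k * 4 + n)

oddEntry : ℕ → ℕ → ℕ
oddEntry n k = ⌊ n /2⌋ + suc (4 * suc k)

oddLayout : ∀ n D k → Layout (oddEntry n k) D (oddBlock n D k)
oddLayout n D k = record
  { lows-gap   = ≤-by (suc (2 * suc k)) (eq₁ x k)
  ; closes     = eq₂ x k
  ; top-above  = ≤-by n (eq₃ x D k n)
  ; highs-gap₂ = ≤-reflexive (eq₄ x D k n)
  ; highs-gap₁ = ≤-reflexive (eq₅ x D k n)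
  ; highs-gapₜ = ≤-by (2 + 2 * suc k) (eq₆ x D k n)
  }
  where
  x = ⌊ n /2⌋
  eq₁ : ∀ x k → x + suc k + suc (2 * suc k) ≡ x + suc (3 * suc k)
  eq₁ = solve-∀
  eq₂ : ∀ x k → x + suc (3 * suc k) + suc k ≡ x + suc (4 * suc k)
  eq₂ = solve-∀
  eq₃ : ∀ x D k n → suc (x + suc (4 * suc k) + D) + n ≡ x + (D + (6 + k * 4 + n))
  eq₃ = solve-∀
  eq₄ : ∀ x D k n → suc (x + (D + (6 + k * 4 + n))) ≡ x + suc (3 * suc k) + (2 + (D + n)) + suc k
  eq₄ = solve-∀
  eq₅ : ∀ x D k n → x + suc (3 * suc k) + (2 + (D + n)) + suc k + suc k ≡ x + suc (D + (6 + k * 4 + n)) + suc k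
  eq₅ = solve-∀
  eq₆ : ∀ x D k n → x + suc (D + (6 + k * 4 + n)) + suc k + suc k + (2 + 2 * suc k)
                    ≡ x + (D + (6 + k * 4 + n) + (3 + 4 * suc k))
  eq₆ = solve-∀

odd-ranges-consecutive : ∀ D k n → let M = D + (6 + k * 4 + n) in
  range (suc D) n ++ range (suc (D + n)) 1 ++ range (2 + (D + n)) (2 * suc k) ++ range (2 + (D + n) + 2 * suc k) 1
    ++ range (3 + (D + n) + 2 * suc k) (suc (2 * k)) ++ range M 1
  ≡ range (suc D) (6 + k * 4 + n)
odd-ranges-consecutive D k n = begin
  range (suc D) n ++ range (suc (D + n)) 1 ++ range (2 + (D + n)) (2 * suc k) ++ range (2 + (D + n) + 2 * suc k) 1
    ++ range (3 + (D + n) + 2 * suc k) (suc (2 * k)) ++ range (D + (6 + k * 4 + n)) 1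
    ≡⟨ range-merge n 1 refl ⟩
  _ ≡⟨ range-merge (n + 1) (2 * suc k) (eq₁ D n) ⟩
  _ ≡⟨ range-merge (n + 1 + 2 * suc k) 1 (eq₂ D k n) ⟩
  _ ≡⟨ range-merge (n + 1 + 2 * suc k + 1) (suc (2 * k)) (eq₃ D k n) ⟩
  range (suc D) (n + 1 + 2 * suc k + 1 + suc (2 * k)) ++ range (D + (6 + k * 4 + n)) 1
    ≡⟨ range-++ (n + 1 + 2 * suc k + 1 + suc (2 * k)) 1 (eq₄ D k n) ⟩
  range (suc D) (n + 1 + 2 * suc k + 1 + suc (2 * k) + 1)
    ≡⟨ cong (range (suc D)) (eq₅ k n) ⟩
  range (suc D) (6 + k * 4 + n) ∎
  where
  open ≡-Reasoning
  eq₁ : ∀ D n → suc D + (n + 1) ≡ 2 + (D + n)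
  eq₁ = solve-∀
  eq₂ : ∀ D k n → suc D + (n + 1 + 2 * suc k) ≡ 2 + (D + n) + 2 * suc k
  eq₂ = solve-∀
  eq₃ : ∀ D k n → suc D + (n + 1 + 2 * suc k + 1) ≡ 3 + (D + n) + 2 * suc k
  eq₃ = solve-∀
  eq₄ : ∀ D k n → suc D + (n + 1 + 2 * suc k + 1 + suc (2 * k)) ≡ D + (6 + k * 4 + n)
  eq₄ = solve-∀
  eq₅ : ∀ k n → n + 1 + 2 * suc k + 1 + suc (2 * k) + 1 ≡ 6 + k * 4 + n
  eq₅ = solve-∀

oddBlock-raw-labels : ∀ n D k → let M = D + (6 + k * 4 + n) in
  map edgeLabel (blockWalk (oddEntry n k) (Block.values (oddBlock n D k)))
    ≡ (suc (D + n) ∷ M ∷ rangeDesc (suc (suc M)) (suc (2 * k)) ++ 2 + (D + n) + 2 * suc k ∷ rangeDesc (2 + (D + n)) (2 * suc k))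
      ++ range (M + (3 + 4 * suc k)) n
oddBlock-raw-labels n D k = trans (Block-labels B E _ (Layout.closes (oddLayout n D k)) refl)
  (cong₃ (λ d₁ d₂ d₃ → (d₁ ∷ d₂ ∷ rangeDesc (suc (suc M)) (suc (2 * k)) ++ d₃ ∷ rangeDesc (2 + (D + n)) (2 * suc k))
                         ++ range (M + (3 + 4 * suc k)) n)
     (distance E top (suc (D + n)) (eq₁ x D k n)) (distance′ top x M refl)
     (distance′ _ lo₂ (2 + (D + n) + 2 * suc k) (eq₂ x D k n)))
  where
  B = oddBlock n D k
  open Block B using (top; lo₂)
  x = ⌊ n /2⌋
  E = oddEntry n k
  M = D + (6 + k * 4 + n)
  eq₁ : ∀ x D k n → x + suc (4 * suc k) + suc (D + n) ≡ x + (D + (6 + k * 4 + n))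
  eq₁ = solve-∀
  eq₂ : ∀ x D k n → x + suc (3 * suc k) + (2 + (D + n) + 2 * suc k) ≡ x + k + suc (suc (D + (6 + k * 4 + n)))
  eq₂ = solve-∀

oddBlock-folded-labels : ∀ n D k → let M = D + (6 + k * 4 + n) in
  map (fold M) (map edgeLabel (blockWalk (oddEntry n k) (Block.values (oddBlock n D k))))
    ≡ (suc (D + n) ∷ M ∷ range (3 + (D + n) + 2 * suc k) (suc (2 * k)) ++ 2 + (D + n) + 2 * suc k ∷ rangeDesc (2 + (D + n)) (2 * suc k))
      ++ rangeDesc (suc D) n
oddBlock-folded-labels n D k = begin
  map (fold M) (map edgeLabel (blockWalk (oddEntry n k) (Block.values (oddBlock n D k))))
    ≡⟨ cong (map (fold M)) (oddBlock-raw-labels n D k) ⟩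
  map (fold M) ((a ∷ M ∷ X ++ c ∷ Y) ++ T)
    ≡⟨ map-++ (fold M) (a ∷ M ∷ X ++ c ∷ Y) T ⟩
  (fold M a ∷ fold M M ∷ map (fold M) (X ++ c ∷ Y)) ++ map (fold M) T
    ≡⟨ cong (λ w → (fold M a ∷ fold M M ∷ w) ++ map (fold M) T) (map-++ (fold M) X (c ∷ Y)) ⟩
  (fold M a ∷ fold M M ∷ map (fold M) X ++ fold M c ∷ map (fold M) Y) ++ map (fold M) T
    ≡⟨ cong₂ _++_
         (cong₂ _∷_ (fold-≤ a≤M) (cong₂ _∷_ (fold-≤ ≤-refl) (cong₂ _++_ (fold-rangeDesc M b (suc (2 * k)) (eq₁ D k n))
           (cong₂ _∷_ (fold-≤ c≤M) (map-fold-rangeDesc-≤ (2 + (D + n)) (2 * suc k) (≤-trans c≤M (n≤1+n M)))))))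
         (fold-range M D _ n (eq₂ D k n) (≤-by (6 + k * 4) (eq₃ D k n))) ⟩
  (a ∷ M ∷ range b (suc (2 * k)) ++ c ∷ Y) ++ rangeDesc (suc D) n ∎
  where
  open ≡-Reasoning
  M = D + (6 + k * 4 + n)
  a = suc (D + n)
  b = 3 + (D + n) + 2 * suc k
  c = 2 + (D + n) + 2 * suc k
  X = rangeDesc (suc (suc M)) (suc (2 * k))
  Y = rangeDesc (2 + (D + n)) (2 * suc k)
  T = range (M + (3 + 4 * suc k)) n
  eq₁ : ∀ D k n → 3 + (D + n) + 2 * suc k + suc (2 * k) ≡ D + (6 + k * 4 + n)
  eq₁ = solve-∀
  eq₂ : ∀ D k n → D + (6 + k * 4 + n) + (3 + 4 * suc k) + n + D ≡ 2 * (D + (6 + k * 4 + n)) + 1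
  eq₂ = solve-∀
  eq₃ : ∀ D k n → D + n + (6 + k * 4) ≡ D + (6 + k * 4 + n)
  eq₃ = solve-∀
  eq₄ : ∀ D k n → suc (D + n) + (5 + k * 4) ≡ D + (6 + k * 4 + n)
  eq₄ = solve-∀
  eq₅ : ∀ D k n → 2 + (D + n) + 2 * suc k + 2 * suc k ≡ D + (6 + k * 4 + n)
  eq₅ = solve-∀
  a≤M : a ≤ M
  a≤M = ≤-by (5 + k * 4) (eq₄ D k n)
  c≤M : c ≤ M
  c≤M = ≤-by (2 * suc k) (eq₅ D k n)

oddBlock-labels : ∀ n D k → let M = D + (6 + k * 4 + n) in
  map (fold M) (map edgeLabel (blockWalk (oddEntry n k) (Block.values (oddBlock n D k)))) ↭ range (suc D) (6 + k * 4 + n)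
oddBlock-labels n D k = begin
  map (fold M) (map edgeLabel (blockWalk (oddEntry n k) (Block.values (oddBlock n D k))))
    ≡⟨ oddBlock-folded-labels n D k ⟩
  (a ∷ M ∷ range b (suc (2 * k)) ++ c ∷ rangeDesc (2 + (D + n)) (2 * suc k)) ++ rangeDesc (suc D) n
    ↭⟨ ++⁺ (++⁺ˡ (a ∷ M ∷ range b (suc (2 * k))) (↭-prep c (rangeDesc↭range (2 + (D + n)) (2 * suc k))))
           (rangeDesc↭range (suc D) n) ⟩
  ([ a ] ++ [ M ] ++ range b (suc (2 * k)) ++ [ c ] ++ range (2 + (D + n)) (2 * suc k)) ++ range (suc D) n
    ↭⟨ regroup [ a ] [ M ] (range b (suc (2 * k))) [ c ] (range (2 + (D + n)) (2 * suc k)) (range (suc D) n) ⟩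
  range (suc D) n ++ [ a ] ++ range (2 + (D + n)) (2 * suc k) ++ [ c ] ++ range b (suc (2 * k)) ++ [ M ]
    ≡⟨ odd-ranges-consecutive D k n ⟩
  range (suc D) (6 + k * 4 + n) ∎
  where
  open PermutationReasoning
  M = D + (6 + k * 4 + n)
  a = suc (D + n)
  b = 3 + (D + n) + 2 * suc k
  c = 2 + (D + n) + 2 * suc k
  regroup : ∀ a m X c Y T → (a ++ m ++ X ++ c ++ Y) ++ T ↭ T ++ a ++ Y ++ c ++ X ++ m
  regroup = solve 6 (λ a m X c Y T → (a ⊕ m ⊕ X ⊕ c ⊕ Y) ⊕ T ⊜ T ⊕ a ⊕ Y ⊕ c ⊕ X ⊕ m) ↭-refl
    where open ++-Solver

data LastBlock : Set where
  even odd : (k n : ℕ) → LastBlock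

innerShape : ℕ × ℕ → ℕ × ℕ
innerShape (k , q) = 4 + k * 4 , q * 2

lastShape : LastBlock → ℕ × ℕ
lastShape (even k n) = 4 + k * 4 , n
lastShape (odd k n)  = 6 + k * 4 , n

edgeCount : ℕ × ℕ → ℕ
edgeCount (m , n) = m + n

size : List (ℕ × ℕ) → LastBlock → ℕ
size []       l = edgeCount (lastShape l)
size (b ∷ ks) l = edgeCount (innerShape b) + size ks l

entry : List (ℕ × ℕ) → LastBlock → ℕ
entry []             (even k n) = evenEntry 0 n k
entry []             (odd k n)  = oddEntry n k
entry ((k , q) ∷ ks) l          = evenEntry (entry ks l) (q * 2) k

-- D is the number of edges in the preceding blocks.
blocks : List (ℕ × ℕ) → LastBlock → ℕ → List Block
blocks []             (even k n) D = [ evenBlock 0 n D k ]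
blocks []             (odd k n)  D = [ oddBlock n D k ]
blocks ((k , q) ∷ ks) l          D = evenBlock (entry ks l) (q * 2) D k ∷ blocks ks l (D + edgeCount (innerShape (k , q)))

blockValues : List (ℕ × ℕ) → LastBlock → ℕ → List (List ℕ × List ℕ)
blockValues ks l D = map Block.values (blocks ks l D)

blockValues-shapes : ∀ ks l D → map shapeOf (blockValues ks l D) ≡ map innerShape ks ++ [ lastShape l ]
blockValues-shapes []             (even k n) D = cong [_] (trans (Block-shape (evenBlock 0 n D k)) (cong (_, n) (eq k)))
  where
  eq : ∀ k → 2 + (2 * suc k + 2 * k) ≡ 4 + k * 4
  eq = solve-∀
blockValues-shapes []             (odd k n)  D = cong [_] (trans (Block-shape (oddBlock n D k)) (cong (_, n) (eq k)))
  where
  eq : ∀ k → 2 + (2 * suc k + 2 * suc k) ≡ 6 + k * 4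
  eq = solve-∀
blockValues-shapes ((k , q) ∷ ks) l D = cong₂ _∷_
  (trans (Block-shape (evenBlock (entry ks l) (q * 2) D k)) (cong (_, q * 2) (eq k)))
  (blockValues-shapes ks l _)
  where
  eq : ∀ k → 2 + (2 * suc k + 2 * k) ≡ 4 + k * 4
  eq = solve-∀

blocksWalk-cons : ∀ k q ks l D → let E = entry ((k , q) ∷ ks) l; B = evenBlock (entry ks l) (q * 2) D k in
  blocksWalk E (blockValues ((k , q) ∷ ks) l D)
    ≡ blockWalk E (Block.values B) ++ blocksWalk (entry ks l) (blockValues ks l (D + edgeCount (innerShape (k , q))))
blocksWalk-cons k q ks l D =
  cong (λ e → blockWalk (entry ((k , q) ∷ ks) l) (Block.values B) ++ blocksWalk e (blockValues ks l (D + edgeCount (innerShape (k , q)))))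
    (tailValues-walkEnd (entry ks l) (Block.start B) q)
  where
  B = evenBlock (entry ks l) (q * 2) D k

blocksWalk-single : ∀ E v → blocksWalk E [ v ] ≡ blockWalk E v
blocksWalk-single E (cyc , tl) = ++-identityʳ _

blocks-labels : ∀ ks l D {M} → D + size ks l ≡ M →
  map (fold M) (map edgeLabel (blocksWalk (entry ks l) (blockValues ks l D))) ↭ range (suc D) (size ks l)
blocks-labels [] (even k n) D {M} eq =
  subst (λ w → map (fold M) (map edgeLabel w) ↭ range (suc D) (4 + k * 4 + n))
    (sym (blocksWalk-single _ (Block.values (evenBlock 0 n D k))))
    (fold-↭-range (evenBlock-labels 0 n D k) (≤-reflexive eq))
blocks-labels [] (odd k n) D refl =
  subst (λ w → map (fold (D + (6 + k * 4 + n))) (map edgeLabel w) ↭ range (suc D) (6 + k * 4 + n))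
    (sym (blocksWalk-single _ (Block.values (oddBlock n D k))))
    (oddBlock-labels n D k)
blocks-labels ((k , q) ∷ ks) l D {M} eq = begin
  map (fold M) (map edgeLabel (blocksWalk (entry ((k , q) ∷ ks) l) (blockValues ((k , q) ∷ ks) l D)))
    ≡⟨ cong (map (fold M) ∘ map edgeLabel) (blocksWalk-cons k q ks l D) ⟩
  map (fold M) (map edgeLabel (blockWalk _ (Block.values B) ++ rest))
    ≡⟨ cong (map (fold M)) (map-++ edgeLabel (blockWalk _ (Block.values B)) rest) ⟩
  map (fold M) (map edgeLabel (blockWalk _ (Block.values B)) ++ map edgeLabel rest)
    ≡⟨ map-++ (fold M) (map edgeLabel (blockWalk _ (Block.values B))) (map edgeLabel rest) ⟩
  map (fold M) (map edgeLabel (blockWalk _ (Block.values B))) ++ map (fold M) (map edgeLabel rest)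
    ↭⟨ ++⁺ (fold-↭-range (evenBlock-labels (entry ks l) (q * 2) D k)
             (≤-trans (m≤m+n _ (size ks l)) (≤-reflexive (trans (+-assoc D _ _) eq))))
           (blocks-labels ks l (D + s) (trans (+-assoc D s (size ks l)) eq)) ⟩
  range (suc D) s ++ range (suc (D + s)) (size ks l)
    ≡⟨ range-++ s (size ks l) refl ⟩
  range (suc D) (s + size ks l) ∎
  where
  open PermutationReasoning
  B = evenBlock (entry ks l) (q * 2) D k
  s = edgeCount (innerShape (k , q))
  rest = blocksWalk (entry ks l) (blockValues ks l (D + s))

blocks-crosses : ∀ ks l D {L} → entry ks l ≤ L → L ≤ entry ks l + D →
  All (Crosses L) (blocksWalk (entry ks l) (blockValues ks l D))
blocks-crosses [] (even k n) D {L} E≤L L≤E+D =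
  subst (All (Crosses L)) (sym (blocksWalk-single _ (Block.values (evenBlock 0 n D k))))
    (Layout-crosses (evenLayout 0 n D k) E≤L L≤E+D)
blocks-crosses [] (odd k n) D {L} E≤L L≤E+D =
  subst (All (Crosses L)) (sym (blocksWalk-single _ (Block.values (oddBlock n D k))))
    (Layout-crosses (oddLayout n D k) E≤L L≤E+D)
blocks-crosses ((k , q) ∷ ks) l D {L} E≤L L≤E+D =
  subst (All (Crosses L)) (sym (blocksWalk-cons k q ks l D)) (AllP.++⁺
    (Layout-crosses (evenLayout N (q * 2) D k) E≤L L≤E+D)
    (blocks-crosses ks l (D + (4 + k * 4 + q * 2)) (≤-trans (≤-trans (m≤m+n N _) (m≤m+n _ (2 * suc k))) E≤L)
      (≤-trans L≤E+D (≤-trans (+-monoˡ-≤ D (+-monoˡ-≤ (2 * suc k) (+-monoʳ-≤ N (⌊n/2⌋≤n (q * 2)))))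
        (≤-by (2 * suc k) (eq N k q D))))))
  where
  N = entry ks l
  eq : ∀ N k q D → N + q * 2 + 2 * suc k + D + 2 * suc k ≡ N + (D + (4 + k * 4 + q * 2))
  eq = solve-∀

blocks-split : ∀ ks l D → SplitsAround 0 (entry ks l) D (suc (D + 2 * size ks l)) (vertexValues (blockValues ks l D))
blocks-split [] (even k n) D = subst (SplitsAround 0 _ D _) (sym (++-identityʳ _))
  (SplitsAround-upper (≤-trans (≤-reflexive (⌊n/2⌋+c+⌈n/2⌉ 0 n _)) (≤-by (4 + k * 4 + n) (eq D k n)))
    (Layout-splits (evenLayout 0 n D k)))
  where
  eq : ∀ D k n → n + suc (D + 4 * suc k) + (4 + k * 4 + n) ≡ suc (D + 2 * (4 + k * 4 + n))
  eq = solve-∀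
blocks-split [] (odd k n) D = subst (SplitsAround 0 _ D _) (sym (++-identityʳ _))
  (SplitsAround-upper (≤-reflexive (trans (⌊n/2⌋+c+⌈n/2⌉ 0 n _) (eq D k n)))
    (Layout-splits (oddLayout n D k)))
  where
  eq : ∀ D k n → n + (D + (6 + k * 4 + n) + (3 + 4 * suc k)) ≡ suc (D + 2 * (6 + k * 4 + n))
  eq = solve-∀
blocks-split ((k , q) ∷ ks) l D =
  SplitsAround-upper (≤-by (4 + k * 4 + q * 2) (eq₂ D k q (size ks l)))
    (SplitsAround-++ (Layout-splits (evenLayout N (q * 2) D k))
      (≤-reflexive (trans (⌊n/2⌋+c+⌈n/2⌉ N (q * 2) _) (eq₁ N D k q)))
      (blocks-split ks l (D + (4 + k * 4 + q * 2))))
  where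
  N = entry ks l
  eq₁ : ∀ N D k q → N + q * 2 + suc (D + 4 * suc k) ≡ suc (N + (D + (4 + k * 4 + q * 2)))
  eq₁ = solve-∀
  eq₂ : ∀ D k q S → suc (D + (4 + k * 4 + q * 2) + 2 * S) + (4 + k * 4 + q * 2) ≡ suc (D + 2 * (4 + k * 4 + q * 2 + S))
  eq₂ = solve-∀

blocks-vertexValues : ∀ ks l → let values = entry ks l ∷ vertexValues (blockValues ks l 0) in
  Unique values × All (_< suc (2 * size ks l)) values
blocks-vertexValues ks l with SplitsAround-insert (blocks-split ks l 0)
... | _ , ↭ys , ys↑ =
  Unique-resp-↭ (↭-sym ↭ys) (IncreasingIn⇒Unique ys↑) , All-resp-↭ (↭-sym ↭ys) (All.map proj₂ (IncreasingIn⇒All ys↑))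

Cgraph-uniformlyOrdered : ∀ ks l → HasUniformlyOrderedLabeling (Cgraph (map innerShape ks ++ [ lastShape l ]))
Cgraph-uniformlyOrdered ks l =
  subst (HasUniformlyOrderedLabeling ∘ Cgraph) (blockValues-shapes ks l 0)
    (folded-labels⇒uniformlyOrdered G f L injective bounded folded↭ crosses)
  where
  vs = blockValues ks l 0
  G = Cgraph (map shapeOf vs)
  L = entry ks l
  values = L ∷ vertexValues vs
  f = valueAt values
  S = size ks l
  m = length (edges G)
  walk≡ : image f (edges G) ≡ blocksWalk L vs
  walk≡ = image-build f 0 1 vs (AllP.map⁺ (All.universal Block-hasExit (blocks ks l 0)))
                      (proj₂ (valueAt-enumerates values))
  labels≡ : edgeLabels f (edges G) ≡ map edgeLabel (blocksWalk L vs)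
  labels≡ = trans (map-∘ (edges G)) (cong (map edgeLabel) walk≡)
  labels↭ : map (fold S) (map edgeLabel (blocksWalk L vs)) ↭ range 1 S
  labels↭ = blocks-labels ks l 0 refl
  m≡S : m ≡ S
  m≡S = begin
    length (edges G)                                  ≡⟨ length-map (Product.map f f) (edges G) ⟨
    length (image f (edges G))                        ≡⟨ cong length walk≡ ⟩
    length (blocksWalk L vs)                               ≡⟨ length-map edgeLabel (blocksWalk L vs) ⟨
    length (map edgeLabel (blocksWalk L vs))               ≡⟨ length-map (fold S) (map edgeLabel (blocksWalk L vs)) ⟨
    length (map (fold S) (map edgeLabel (blocksWalk L vs))) ≡⟨ ↭-length labels↭ ⟩
    length (range 1 S)                                ≡⟨ length-range 1 S ⟩
    S                                                 ∎
    where open ≡-Reasoning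
  folded↭ : map (fold m) (edgeLabels f (edges G)) ↭ range 1 m
  folded↭ rewrite labels≡ | m≡S = labels↭
  values-unique : Unique values
  values-unique = proj₁ (blocks-vertexValues ks l)
  values-bounded : All (_< suc (2 * S)) values
  values-bounded = proj₂ (blocks-vertexValues ks l)
  vertex< : ∀ {v} → v < nV G → v < length values
  vertex< {v} = subst (λ n → v < suc n) (vertexCount-shapes vs)
  injective : ∀ u v → u < nV G → v < nV G → f u ≡ f v → u ≡ v
  injective u v u< v< = valueAt-injective values values-unique (vertex< u<) (vertex< v<)
  bounded : ∀ v → v < nV G → f v ≤ 2 * m
  bounded v v< = subst (λ n → f v ≤ 2 * n) (sym m≡S) (≤-pred (All.lookup values-bounded (valueAt-∈ values (vertex< v<))))
  crosses : All (Crosses L) (image f (edges G))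
  crosses = subst (All (Crosses L)) (sym walk≡) (blocks-crosses ks l 0 ≤-refl (≤-reflexive (sym (+-identityʳ L))))

innerBlock-shape : ∀ {b} → InnerBlockOK b → Σ (ℕ × ℕ) λ kq → innerShape kq ≡ b
innerBlock-shape (()  , divides zero    refl , _)
innerBlock-shape (_   , divides (suc k) refl , divides q refl) = (k , q) , refl

innerBlocks-shape : ∀ {inner} → All InnerBlockOK inner → Σ (List (ℕ × ℕ)) λ ks → map innerShape ks ≡ inner
innerBlocks-shape []          = [] , refl
innerBlocks-shape (ok ∷ oks) =
  proj₁ kq ∷ proj₁ ks , cong₂ _∷_ (proj₂ kq) (proj₂ ks)
  where
  kq = innerBlock-shape ok
  ks = innerBlocks-shape oks

lastBlock-shape : ∀ j n → Σ LastBlock λ l → lastShape l ≡ (4 + j * 2 , n)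
lastBlock-shape zero          n = even 0 n , refl
lastBlock-shape (suc zero)    n = odd 0 n , refl
lastBlock-shape (suc (suc j)) n with lastBlock-shape j n
... | even k n′ , eq = even (suc k) n′ , cong (Product.map₁ (4 +_)) eq
... | odd k n′  , eq = odd (suc k) n′ , cong (Product.map₁ (4 +_)) eq

theorem5 : (inner : List (ℕ × ℕ)) (mₜ nₜ : ℕ) →
    All InnerBlockOK inner → 3 ≤ mₜ → 2 ∣ mₜ →
    HasUniformlyOrderedLabeling (Cgraph (inner ++ [ (mₜ , nₜ) ]))
theorem5 inner mₜ nₜ oks (s≤s (s≤s (s≤s _))) (divides (suc (suc j)) refl) =
  subst₂ (λ ks b → HasUniformlyOrderedLabeling (Cgraph (ks ++ [ b ])))
    (proj₂ (innerBlocks-shape oks)) (proj₂ (lastBlock-shape j nₜ))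
    (Cgraph-uniformlyOrdered (proj₁ (innerBlocks-shape oks)) (proj₁ (lastBlock-shape j nₜ)))
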